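{- Let $n$ and $s$ be positive integers, $\zeta_n=e^{2\pi\sqrt{ -1}/n}$, and $\mathfrak Z_n(\zeta_n;;s)=\sum_{i=1}^{n-1}\frac{1}{(1-\zeta_n^i)^s}$. Then $$\mathfrak Z_n(\zeta_n;;s)=\frac{(-1)^s n^{s+1}}{(s+1)!}\left(\beta_{s+1}\left(\frac{n-1}{n}\,\Big|\,\frac{1}{n}\right)-\beta_{s+1}\left(0\,\Big|\,\frac{1}{n}\right)\right).$$
   Context: The degenerate Bernoulli polynomials $\beta_k(x|\lambda)$ (Carlitz) are defined by $\dfrac{t(1+\lambda t)^{x/\lambda}}{(1+\lambda t)^{1/\lambda}-1}=\sum_{k=0}^\infty\beta_k(x|\lambda)\dfrac{t^k}{k!}$. -}

module Defs where

open import Level using (Level)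
open import Data.Nat as ℕ using (ℕ; zero; suc; _!; NonZero)
open import Data.Nat.Combinatorics using (_C_)
open import Data.Nat.Properties using (_!≢0)
open import Data.Integer as ℤ using (ℤ)
open import Data.Rational as ℚ using (ℚ; 0ℚ; 1ℚ; _+_; _*_; _-_; -_)
open import Data.List using (List; []; _∷_)
open import Algebra.Bundles using (CommutativeRing)

-- Exponential generating functions over ℚ, represented by their
-- coefficient sequence: a series Σ a_k t^k / k!  is the function k ↦ a_k.

EGF : Set
EGF = ℕ → ℚ

ℕ→ℚ : ℕ → ℚ
ℕ→ℚ n = ℤ.+ n ℚ./ 1

sumℚ : ℕ → ℕ → (ℕ → ℚ) → ℚ
sumℚ lo zero    f = 0ℚ
sumℚ lo (suc l) f = f lo + sumℚ (suc lo) l f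

_·ₑ_ : EGF → EGF → EGF
(a ·ₑ b) k = sumℚ 0 (suc k) (λ j → ℕ→ℚ (k C j) * a j * b (k ℕ.∸ j))

-- Multiplicative inverse of an EGF a with a_0 = 1.
-- invRev a k = [b_k , b_{k-1} , … , b_0]  where b = a⁻¹, i.e.
-- b_0 = 1 and b_K = - Σ_{j=1}^{K} C(K,j) a_j b_{K-j}   (K ≥ 1).
private
  weighted : ℕ → EGF → ℕ → List ℚ → ℚ
  weighted K a j []       = 0ℚ
  weighted K a j (r ∷ rs) = ℕ→ℚ (K C j) * a j * r + weighted K a (suc j) rs

  hd : List ℚ → ℚ
  hd []      = 0ℚ
  hd (x ∷ _) = x

invRev : EGF → ℕ → List ℚ
invRev a zero    = 1ℚ ∷ []
invRev a (suc k) = (- weighted (suc k) a 1 (invRev a k)) ∷ invRev a k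

invₑ : EGF → EGF
invₑ a k = hd (invRev a k)

fallingλ : ℚ → ℚ → ℕ → ℚ
fallingλ x λ′ zero    = 1ℚ
fallingλ x λ′ (suc m) = fallingλ x λ′ m * (x - ℕ→ℚ m * λ′)

-- (1 + λ t)^{x/λ} = Σ_k (x|λ)_k t^k / k!
binomλ : ℚ → ℚ → EGF
binomλ λ′ x = fallingλ x λ′

-- ((1 + λ t)^{1/λ} - 1) / t = Σ_k (1|λ)_{k+1} / (k+1) · t^k / k!
denomλ : ℚ → EGF
denomλ λ′ k = fallingλ 1ℚ λ′ (suc k) * (ℤ.+ 1 ℚ./ suc k)

-- Carlitz degenerate Bernoulli polynomials:
--   t (1+λt)^{x/λ} / ((1+λt)^{1/λ} - 1) = Σ_k β_k(x|λ) t^k / k!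
β : ℕ → ℚ → ℚ → ℚ
β k x λ′ = (invₑ (denomλ λ′) ·ₑ binomλ λ′ x) k

rhs : (n s : ℕ) → .{{NonZero n}} → ℚ
rhs n s = coeff * (β (suc s) ((ℤ.+ (n ℕ.∸ 1)) ℚ./ n) (ℤ.+ 1 ℚ./ n)
                  - β (suc s) 0ℚ (ℤ.+ 1 ℚ./ n))
  where
  instance _ = suc s !≢0
  coeff : ℚ
  coeff = ((ℤ.- ℤ.1ℤ) ℤ.^ s ℤ.* ℤ.+ (n ℕ.^ suc s)) ℚ./ (suc s !)

module _ {c ℓ : Level} (R : CommutativeRing c ℓ) where
  open CommutativeRing R using (Carrier) renaming (_*_ to _*ᴿ_; _+_ to _+ᴿ_; 1# to 1ᴿ; 0# to 0ᴿ)

  pow : Carrier → ℕ → Carrier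
  pow x zero    = 1ᴿ
  pow x (suc m) = x *ᴿ pow x m

  sumR : ℕ → ℕ → (ℕ → Carrier) → Carrier
  sumR lo zero    f = 0ᴿ
  sumR lo (suc l) f = f lo +ᴿ sumR (suc lo) l f

{-# OPTIONS --safe #-}
module Submission where

-- Put λ = 1/n and work in R[[t]], where Y = 1 + λt and D = ((1 + λt)^(1/λ) - 1)/t satisfy
-- t D = Yⁿ - 1. The exponential generating functions B_x of β(x | λ) satisfy D B_x = (1 + λt)^(x/λ),
-- so Δ = B_((n-1)/n) - B_0 satisfies D Δ = Yⁿ⁻¹ - 1.
-- Since wᵢ (1 - ζⁱ) = 1, we get Y - ζⁱ = (1 - ζⁱ)(1 + λ wᵢ t), and ∑_{i<n} ζ^(i j) = 0 for 0 < j < n.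
-- A partial-fraction computation then gives (Yⁿ - 1) ∑_{i=1}^{n-1} 1/(1 + λ wᵢ t) = n (Yⁿ⁻¹ - 1),
-- so after cancelling D, t ∑ᵢ 1/(1 + λ wᵢ t) = n Δ. The coefficient of t^(s+1) gives
-- ∑ᵢ (-λ wᵢ)ˢ = n (β_(s+1)((n-1)/n | λ) - β_(s+1)(0 | λ)) / (s+1)!, which is the theorem.

open import Defs
open import Level using (Level)
open import Data.Nat using (ℕ; suc; _≤_; _<_; _∸_; NonZero)
open import Data.Rational using (ℚ)
open import Data.Rational.Properties using (+-*-rawRing)
open import Algebra.Bundles using (CommutativeRing)
open import Algebra.Morphism.Structures using (module RingMorphisms)
open import Relation.Binary.PropositionalEquality as ≡ using (_≡_)
open import Relation.Binary.Bundles using (Setoid)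
import Relation.Binary.Reasoning.Setoid

module RationalArithmetic where
  open import Data.Nat as ℕ using (suc; _!)
  import Data.Nat.Properties as ℕ
  open import Data.Nat.Combinatorics using (_C_; k![n∸k]!∣n!)
  open import Data.Nat.Combinatorics.Specification using (nCk≡n!/k![n-k]!)
  open import Data.Nat.DivMod using (m/n*n≡m)
  open import Data.Integer as ℤ using (ℤ; +_)
  import Data.Integer.Properties as ℤ
  open import Data.Rational as ℚ using (1ℚ; _/_; _*_; toℚᵘ; fromℚᵘ)
  import Data.Rational.Properties as ℚ
  open import Data.Rational.Properties
    using (toℚᵘ-injective; toℚᵘ-fromℚᵘ; fromℚᵘ-cong; toℚᵘ-homo-+; toℚᵘ-homo-*)
  import Data.Rational.Unnormalised as ℚᵘ
  import Data.Rational.Unnormalised.Properties as ℚᵘ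
  open ≡ using (cong; cong₂)

  fromℚᵘ-homo-+ : ∀ p q → fromℚᵘ (p ℚᵘ.+ q) ≡ fromℚᵘ p ℚ.+ fromℚᵘ q
  fromℚᵘ-homo-+ p q = toℚᵘ-injective (begin
    toℚᵘ (fromℚᵘ (p ℚᵘ.+ q))               ≈⟨ toℚᵘ-fromℚᵘ (p ℚᵘ.+ q) ⟩
    p ℚᵘ.+ q                                ≈⟨ ℚᵘ.+-cong (toℚᵘ-fromℚᵘ p) (toℚᵘ-fromℚᵘ q) ⟨
    toℚᵘ (fromℚᵘ p) ℚᵘ.+ toℚᵘ (fromℚᵘ q)    ≈⟨ toℚᵘ-homo-+ (fromℚᵘ p) (fromℚᵘ q) ⟨
    toℚᵘ (fromℚᵘ p ℚ.+ fromℚᵘ q)              ∎)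
    where open ℚᵘ.≃-Reasoning

  fromℚᵘ-homo-* : ∀ p q → fromℚᵘ (p ℚᵘ.* q) ≡ fromℚᵘ p * fromℚᵘ q
  fromℚᵘ-homo-* p q = toℚᵘ-injective (begin
    toℚᵘ (fromℚᵘ (p ℚᵘ.* q))               ≈⟨ toℚᵘ-fromℚᵘ (p ℚᵘ.* q) ⟩
    p ℚᵘ.* q                                ≈⟨ ℚᵘ.*-cong (toℚᵘ-fromℚᵘ p) (toℚᵘ-fromℚᵘ q) ⟨
    toℚᵘ (fromℚᵘ p) ℚᵘ.* toℚᵘ (fromℚᵘ q)    ≈⟨ toℚᵘ-homo-* (fromℚᵘ p) (fromℚᵘ q) ⟨
    toℚᵘ (fromℚᵘ p * fromℚᵘ q)              ∎)
    where open ℚᵘ.≃-Reasoning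

  -- i / suc d is definitionally fromℚᵘ (mkℚᵘ i d), so identities between fractions reduce to ℚᵘ.
  /≡/ : ∀ i j a b .{{_ : NonZero a}} .{{_ : NonZero b}} →
        i ℤ.* + b ≡ j ℤ.* + a → i / a ≡ j / b
  /≡/ i j (suc a) (suc b) eq = fromℚᵘ-cong {ℚᵘ.mkℚᵘ i a} {ℚᵘ.mkℚᵘ j b} (ℚᵘ.*≡* eq)

  /-+-/ : ∀ i j a b .{{_ : NonZero a}} .{{_ : NonZero b}} →
          i / a ℚ.+ j / b ≡ ((i ℤ.* + b ℤ.+ j ℤ.* + a) / (a ℕ.* b)) {{ℕ.m*n≢0 a b}}
  /-+-/ i j (suc a) (suc b) = ≡.sym (fromℚᵘ-homo-+ (ℚᵘ.mkℚᵘ i a) (ℚᵘ.mkℚᵘ j b))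

  /-*-/ : ∀ i j a b .{{_ : NonZero a}} .{{_ : NonZero b}} →
          (i / a) * (j / b) ≡ ((i ℤ.* j) / (a ℕ.* b)) {{ℕ.m*n≢0 a b}}
  /-*-/ i j (suc a) (suc b) = ≡.sym (fromℚᵘ-homo-* (ℚᵘ.mkℚᵘ i a) (ℚᵘ.mkℚᵘ j b))

  ℕ→ℚ-suc : ∀ m → ℕ→ℚ (suc m) ≡ 1ℚ ℚ.+ ℕ→ℚ m
  ℕ→ℚ-suc m = ≡.sym (≡.trans (/-+-/ (+ 1) (+ m) 1 1) (/≡/ (+ 1 ℤ.* + 1 ℤ.+ + m ℤ.* + 1) (+ suc m) 1 1 eq))
    where
    eq : (+ 1 ℤ.* + 1 ℤ.+ + m ℤ.* + 1) ℤ.* + 1 ≡ + suc m ℤ.* + 1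
    eq = cong (ℤ._* + 1) (≡.trans (cong (ℤ._+_ (+ 1)) (ℤ.*-identityʳ (+ m))) (≡.sym (ℤ.pos-+ 1 m)))

  ℕ→ℚ-suc-* : ∀ m x → ℕ→ℚ (suc m) * x ≡ ℕ→ℚ m * x ℚ.+ x
  ℕ→ℚ-suc-* m x = begin
    ℕ→ℚ (suc m) * x           ≡⟨ cong (_* x) (ℕ→ℚ-suc m) ⟩
    (1ℚ ℚ.+ ℕ→ℚ m) * x        ≡⟨ ℚ.*-distribʳ-+ x 1ℚ (ℕ→ℚ m) ⟩
    1ℚ * x ℚ.+ ℕ→ℚ m * x      ≡⟨ cong (ℚ._+ ℕ→ℚ m * x) (ℚ.*-identityˡ x) ⟩
    x ℚ.+ ℕ→ℚ m * x           ≡⟨ ℚ.+-comm x (ℕ→ℚ m * x) ⟩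
    ℕ→ℚ m * x ℚ.+ x           ∎
    where open ≡.≡-Reasoning

  ℕ→ℚ-homo-* : ∀ a b → ℕ→ℚ (a ℕ.* b) ≡ ℕ→ℚ a * ℕ→ℚ b
  ℕ→ℚ-homo-* a b = ≡.trans (cong (_/ 1) (ℤ.pos-* a b)) (≡.sym (/-*-/ (+ a) (+ b) 1 1))

  ℕ→ℚ-*-inverse : ∀ a .{{_ : NonZero a}} → ℕ→ℚ a * (+ 1 / a) ≡ 1ℚ
  ℕ→ℚ-*-inverse a = ≡.trans (/-*-/ (+ a) (+ 1) 1 a) (/≡/ (+ a ℤ.* + 1) (+ 1) (1 ℕ.* a) 1 {{ℕ.m*n≢0 1 a}} eq)
    where
    open ≡.≡-Reasoning
    eq : (+ a ℤ.* + 1) ℤ.* + 1 ≡ + 1 ℤ.* + (1 ℕ.* a)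
    eq = begin
      (+ a ℤ.* + 1) ℤ.* + 1  ≡⟨ ℤ.*-identityʳ _ ⟩
      + a ℤ.* + 1            ≡⟨ ℤ.*-identityʳ _ ⟩
      + a                    ≡⟨ cong +_ (ℕ.*-identityˡ a) ⟨
      + (1 ℕ.* a)            ≡⟨ ℤ.*-identityˡ _ ⟨
      + 1 ℤ.* + (1 ℕ.* a)    ∎

  /-as-* : ∀ i d .{{_ : NonZero d}} → i / d ≡ (i / 1) * (+ 1 / d)
  /-as-* i d = ≡.sym (≡.trans (/-*-/ i (+ 1) 1 d) (/≡/ (i ℤ.* + 1) i (1 ℕ.* d) d {{ℕ.m*n≢0 1 d}} eq))
    where
    eq : (i ℤ.* + 1) ℤ.* + d ≡ i ℤ.* + (1 ℕ.* d)
    eq = cong₂ ℤ._*_ (ℤ.*-identityʳ i) (cong +_ (≡.sym (ℕ.*-identityˡ d)))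

  1/[_!] : ℕ → ℚ
  1/[ k !] = (+ 1 / k !) {{k ℕ.!≢0}}

  1/[suc!] : ∀ k → 1/[ suc k !] ≡ (+ 1 / suc k) * 1/[ k !]
  1/[suc!] k = ≡.sym (/-*-/ (+ 1) (+ 1) (suc k) (k !) {{_}} {{k ℕ.!≢0}})

  suc-*-1/[suc!] : ∀ k → ℕ→ℚ (suc k) * 1/[ suc k !] ≡ 1/[ k !]
  suc-*-1/[suc!] k = begin
    ℕ→ℚ (suc k) * 1/[ suc k !]                    ≡⟨ cong (ℕ→ℚ (suc k) *_) (1/[suc!] k) ⟩
    ℕ→ℚ (suc k) * ((+ 1 / suc k) * 1/[ k !])      ≡⟨ ≡.sym (ℚ.*-assoc (ℕ→ℚ (suc k)) (+ 1 / suc k) 1/[ k !]) ⟩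
    ℕ→ℚ (suc k) * (+ 1 / suc k) * 1/[ k !]        ≡⟨ cong (_* 1/[ k !]) (ℕ→ℚ-*-inverse (suc k)) ⟩
    1ℚ * 1/[ k !]                                 ≡⟨ ℚ.*-identityˡ 1/[ k !] ⟩
    1/[ k !]                                      ∎
    where open ≡.≡-Reasoning

  binomial-*-1/[!] : ∀ {K j} → j ≤ K → ℕ→ℚ (K C j) * 1/[ K !] ≡ 1/[ j !] * 1/[ K ∸ j !]
  binomial-*-1/[!] {K} {j} j≤K = begin
    ℕ→ℚ (K C j) * 1/[ K !]                  ≡⟨ /-*-/ (+ (K C j)) (+ 1) 1 (K !) {{_}} {{K ℕ.!≢0}} ⟩
    _                                       ≡⟨ /≡/ (+ (K C j) ℤ.* + 1) (+ 1) (1 ℕ.* K !) d {{_}} {{j ℕ.!* (K ∸ j) !≢0}} eq ⟩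
    ((+ 1 ℤ.* + 1) / d) {{j ℕ.!* (K ∸ j) !≢0}} ≡⟨ /-*-/ (+ 1) (+ 1) (j !) ((K ∸ j) !) {{j ℕ.!≢0}} {{(K ∸ j) ℕ.!≢0}} ⟨
    1/[ j !] * 1/[ K ∸ j !]                 ∎
    where
    open ≡.≡-Reasoning
    d : ℕ
    d = j ! ℕ.* (K ∸ j) !
    C*d≡K! : (K C j) ℕ.* d ≡ K !
    C*d≡K! = ≡.trans (cong (ℕ._* d) (nCk≡n!/k![n-k]! j≤K)) (m/n*n≡m {{j ℕ.!* (K ∸ j) !≢0}} (k![n∸k]!∣n! j≤K))
    eq : (+ (K C j) ℤ.* + 1) ℤ.* + d ≡ + 1 ℤ.* + (1 ℕ.* K !)
    eq = begin
      (+ (K C j) ℤ.* + 1) ℤ.* + d  ≡⟨ cong (ℤ._* + d) (ℤ.*-identityʳ (+ (K C j))) ⟩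
      + (K C j) ℤ.* + d            ≡⟨ ℤ.pos-* (K C j) d ⟨
      + ((K C j) ℕ.* d)            ≡⟨ cong +_ C*d≡K! ⟩
      + (K !)                      ≡⟨ cong +_ (ℕ.*-identityˡ (K !)) ⟨
      + (1 ℕ.* K !)                ≡⟨ ℤ.*-identityˡ (+ (1 ℕ.* K !)) ⟨
      + 1 ℤ.* + (1 ℕ.* K !)        ∎

module ExponentialGeneratingFunctions where
  open import Data.Nat as ℕ using (zero; suc; _+_)
  import Data.Nat.Properties as ℕ
  open import Data.Nat.Combinatorics using (_C_)
  open import Data.Integer using (+_)
  open import Data.Rational as ℚ using (0ℚ; 1ℚ; _/_; _*_; -_; _-_)
  import Data.Rational.Properties as ℚ
  open import Data.Rational.Solver using (module +-*-Solver)
  open import Data.List using (List; []; _∷_)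
  open +-*-Solver
  open RationalArithmetic
  open ≡ using (refl; cong; cong₂)
  open ≡.≡-Reasoning

  1ₑ : EGF
  1ₑ zero    = 1ℚ
  1ₑ (suc _) = 0ℚ

  private
    weightedSum : ℕ → EGF → ℕ → List ℚ → ℚ
    weightedSum K a j []       = 0ℚ
    weightedSum K a j (r ∷ rs) = ℕ→ℚ (K C j) * a j * r ℚ.+ weightedSum K a (suc j) rs

    weightedSum-unique : ∀ a {W : ℕ → ℕ → List ℚ → ℚ} →
      (∀ K j → W K j [] ≡ 0ℚ) →
      (∀ K j r rs → W K j (r ∷ rs) ≡ ℕ→ℚ (K C j) * a j * r ℚ.+ W K (suc j) rs) →
      ∀ K j rs → W K j rs ≡ weightedSum K a j rs
    weightedSum-unique a {W} W[] W∷ K j []       = W[] K j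
    weightedSum-unique a {W} W[] W∷ K j (r ∷ rs) =
      ≡.trans (W∷ K j r rs) (cong (ℕ→ℚ (K C j) * a j * r ℚ.+_) (weightedSum-unique a {W} W[] W∷ K (suc j) rs))

    weightedSum-invRev : ∀ K a j k →
      weightedSum K a j (invRev a k) ≡ sumℚ j (suc k) (λ i → ℕ→ℚ (K C i) * a i * invₑ a (j + k ∸ i))
    weightedSum-invRev K a j zero = cong (λ l → ℕ→ℚ (K C j) * a j * invₑ a l ℚ.+ 0ℚ) (≡.sym j+0∸j≡0)
      where
      j+0∸j≡0 : j + 0 ∸ j ≡ 0
      j+0∸j≡0 = ≡.trans (cong (_∸ j) (ℕ.+-identityʳ j)) (ℕ.n∸n≡0 j)
    weightedSum-invRev K a j (suc k) = cong₂ ℚ._+_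
      (cong (λ l → ℕ→ℚ (K C j) * a j * invₑ a l) (≡.sym (ℕ.m+n∸m≡n j (suc k))))
      (≡.trans (weightedSum-invRev K a (suc j) k)
               (sumℚ-cong (suc j) (suc k) (λ i → cong (λ l → ℕ→ℚ (K C i) * a i * invₑ a (l ∸ i)) (≡.sym (ℕ.+-suc j k)))))
      where
      sumℚ-cong : ∀ lo l {f g : ℕ → ℚ} → (∀ i → f i ≡ g i) → sumℚ lo l f ≡ sumℚ lo l g
      sumℚ-cong lo zero    eq = refl
      sumℚ-cong lo (suc l) eq = cong₂ ℚ._+_ (eq lo) (sumℚ-cong (suc lo) l eq)

    -- The sum used by invRev is private to Defs. Abstracting its arguments lets unification
    -- instantiate W with it, and its defining equations then hold by refl.
    invₑ-suc-weightedSum : ∀ a k → invₑ a (suc k) ≡ - weightedSum (suc k) a 1 (invRev a k)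
    invₑ-suc-weightedSum a k with suc k | 1 | invRev a k | weightedSum-unique a (λ _ _ → refl) (λ _ _ _ _ → refl)
    ... | K | j | rs | unique = cong -_ (unique K j rs)

  invₑ-suc : ∀ a k →
    invₑ a (suc k) ≡ - sumℚ 1 (suc k) (λ i → ℕ→ℚ (suc k C i) * a i * invₑ a (suc k ∸ i))
  invₑ-suc a k = ≡.trans (invₑ-suc-weightedSum a k) (cong -_ (weightedSum-invRev (suc k) a 1 k))

  ·ₑ-invₑ : ∀ a → a 0 ≡ 1ℚ → ∀ k → (a ·ₑ invₑ a) k ≡ 1ₑ k
  ·ₑ-invₑ a a₀≡1 zero    = cong (λ x → 1ℚ * x * 1ℚ ℚ.+ 0ℚ) a₀≡1
  ·ₑ-invₑ a a₀≡1 (suc k) = begin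
    1ℚ * a 0 * invₑ a (suc k) ℚ.+ S   ≡⟨ cong (λ x → 1ℚ * x * invₑ a (suc k) ℚ.+ S) a₀≡1 ⟩
    1ℚ * 1ℚ * invₑ a (suc k) ℚ.+ S    ≡⟨ cong (λ x → 1ℚ * 1ℚ * x ℚ.+ S) (invₑ-suc a k) ⟩
    1ℚ * 1ℚ * (- S) ℚ.+ S             ≡⟨ solve 1 (λ x → con 1ℚ :* con 1ℚ :* (:- x) :+ x := con 0ℚ) refl S ⟩
    0ℚ                                ∎
    where
    S : ℚ
    S = sumℚ 1 (suc k) (λ i → ℕ→ℚ (suc k C i) * a i * invₑ a (suc k ∸ i))

  fallingλ-shift : ∀ x λ′ k → fallingλ (x ℚ.+ λ′) λ′ (suc k) ≡ (x ℚ.+ λ′) * fallingλ x λ′ k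
  fallingλ-shift x λ′ zero    = solve 2 (λ x l → con 1ℚ :* ((x :+ l) :- con 0ℚ :* l) := (x :+ l) :* con 1ℚ) refl x λ′
  fallingλ-shift x λ′ (suc k) = begin
    fallingλ (x ℚ.+ λ′) λ′ (suc k) * ((x ℚ.+ λ′) - ℕ→ℚ (suc k) * λ′)
      ≡⟨ cong₂ (λ p q → p * ((x ℚ.+ λ′) - q * λ′)) (fallingλ-shift x λ′ k) (ℕ→ℚ-suc k) ⟩
    (x ℚ.+ λ′) * F * ((x ℚ.+ λ′) - (1ℚ ℚ.+ ℕ→ℚ k) * λ′)
      ≡⟨ solve 4 (λ x l f k → (x :+ l) :* f :* ((x :+ l) :- (con 1ℚ :+ k) :* l) := (x :+ l) :* (f :* (x :- k :* l))) refl x λ′ F (ℕ→ℚ k) ⟩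
    (x ℚ.+ λ′) * (F * (x - ℕ→ℚ k * λ′)) ∎
    where
    F : ℚ
    F = fallingλ x λ′ k

  fallingλ-+λ : ∀ x λ′ k →
    fallingλ (x ℚ.+ λ′) λ′ (suc k) ≡ fallingλ x λ′ (suc k) ℚ.+ ℕ→ℚ (suc k) * λ′ * fallingλ x λ′ k
  fallingλ-+λ x λ′ k = begin
    fallingλ (x ℚ.+ λ′) λ′ (suc k)
      ≡⟨ fallingλ-shift x λ′ k ⟩
    (x ℚ.+ λ′) * F
      ≡⟨ solve 4 (λ x l f k → (x :+ l) :* f := f :* (x :- k :* l) :+ (con 1ℚ :+ k) :* l :* f) refl x λ′ F (ℕ→ℚ k) ⟩
    F * (x - ℕ→ℚ k * λ′) ℚ.+ (1ℚ ℚ.+ ℕ→ℚ k) * λ′ * F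
      ≡⟨ cong (λ c → F * (x - ℕ→ℚ k * λ′) ℚ.+ c * λ′ * F) (ℕ→ℚ-suc k) ⟨
    F * (x - ℕ→ℚ k * λ′) ℚ.+ ℕ→ℚ (suc k) * λ′ * F ∎
    where
    F : ℚ
    F = fallingλ x λ′ k

  denomλ-0 : ∀ λ′ → denomλ λ′ 0 ≡ 1ℚ
  denomλ-0 λ′ = solve 1 (λ l → con 1ℚ :* (con 1ℚ :- con 0ℚ :* l) :* con 1ℚ := con 1ℚ) refl λ′

  fallingλ-zero : ∀ λ′ k → fallingλ 0ℚ λ′ (suc k) ≡ 0ℚ
  fallingλ-zero λ′ zero    = solve 1 (λ l → con 1ℚ :* (con 0ℚ :- con 0ℚ :* l) := con 0ℚ) refl λ′
  fallingλ-zero λ′ (suc k) = ≡.trans (cong (_* (0ℚ - ℕ→ℚ (suc k) * λ′)) (fallingλ-zero λ′ k))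
                                     (ℚ.*-zeroˡ (0ℚ - ℕ→ℚ (suc k) * λ′))

  binomλ-+λ-coefficient : ∀ λ′ x k →
    binomλ λ′ (x ℚ.+ λ′) (suc k) * 1/[ suc k !] ≡ binomλ λ′ x (suc k) * 1/[ suc k !] ℚ.+ λ′ * (binomλ λ′ x k * 1/[ k !])
  binomλ-+λ-coefficient λ′ x k = begin
    fallingλ (x ℚ.+ λ′) λ′ (suc k) * I′
      ≡⟨ cong (_* I′) (fallingλ-+λ x λ′ k) ⟩
    (A ℚ.+ ℕ→ℚ (suc k) * λ′ * B) * I′
      ≡⟨ solve 5 (λ a n l b i → (a :+ n :* l :* b) :* i := a :* i :+ l :* (b :* (n :* i))) refl A (ℕ→ℚ (suc k)) λ′ B I′ ⟩
    A * I′ ℚ.+ λ′ * (B * (ℕ→ℚ (suc k) * I′))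
      ≡⟨ cong (λ i → A * I′ ℚ.+ λ′ * (B * i)) (suc-*-1/[suc!] k) ⟩
    A * I′ ℚ.+ λ′ * (B * 1/[ k !]) ∎
    where
    A B I′ : ℚ
    A = fallingλ x λ′ (suc k)
    B = fallingλ x λ′ k
    I′ = 1/[ suc k !]

  denomλ-coefficient : ∀ λ′ k → denomλ λ′ k * 1/[ k !] ≡ binomλ λ′ 1ℚ (suc k) * 1/[ suc k !]
  denomλ-coefficient λ′ k = ≡.trans (ℚ.*-assoc (fallingλ 1ℚ λ′ (suc k)) (+ 1 / suc k) 1/[ k !])
                                    (cong (fallingλ 1ℚ λ′ (suc k) *_) (≡.sym (1/[suc!] k)))

  ·ₑ-coefficient : ∀ {K j} → j ≤ K → ∀ A B →
    ℕ→ℚ (K C j) * A * B * 1/[ K !] ≡ (A * 1/[ j !]) * (B * 1/[ K ∸ j !])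
  ·ₑ-coefficient {K} {j} j≤K A B = begin
    ℕ→ℚ (K C j) * A * B * 1/[ K !]
      ≡⟨ solve 4 (λ c a b i → c :* a :* b :* i := (c :* i) :* (a :* b)) refl (ℕ→ℚ (K C j)) A B 1/[ K !] ⟩
    ℕ→ℚ (K C j) * 1/[ K !] * (A * B)
      ≡⟨ cong (_* (A * B)) (binomial-*-1/[!] j≤K) ⟩
    1/[ j !] * 1/[ K ∸ j !] * (A * B)
      ≡⟨ solve 4 (λ p q a b → p :* q :* (a :* b) := (a :* p) :* (b :* q)) refl 1/[ j !] 1/[ K ∸ j !] A B ⟩
    (A * 1/[ j !]) * (B * 1/[ K ∸ j !]) ∎

module FiniteSums {c ℓ : Level} (R : CommutativeRing c ℓ) where
  open import Data.Nat as ℕ using (zero; suc; z≤n; s≤s)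
  import Data.Nat.Properties as ℕ
  open CommutativeRing R
  open import Algebra.Definitions.RawMonoid +-rawMonoid public using (_×_)
  open import Algebra.Properties.CommutativeSemiring.Exp commutativeSemiring public
    using (_^_; ^-congˡ; ^-assocʳ; ^-distrib-*)
  open import Algebra.Properties.Ring ring using (-1*x≈-x)
  open import Algebra.Properties.CommutativeSemigroup +-commutativeSemigroup using (interchange)
  open import Relation.Binary.Reasoning.Setoid setoid

  ∑ : ℕ → ℕ → (ℕ → Carrier) → Carrier
  ∑ = sumR R

  sum-cong : ∀ lo l {f g : ℕ → Carrier} → (∀ i → f i ≈ g i) → ∑ lo l f ≈ ∑ lo l g
  sum-cong lo zero    f≈g = refl
  sum-cong lo (suc l) f≈g = +-cong (f≈g lo) (sum-cong (suc lo) l f≈g)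

  sum-cong-< : ∀ lo l {f g : ℕ → Carrier} →
               (∀ i → lo ≤ i → i < lo ℕ.+ l → f i ≈ g i) → ∑ lo l f ≈ ∑ lo l g
  sum-cong-< lo zero    f≈g = refl
  sum-cong-< lo (suc l) f≈g = +-cong (f≈g lo ℕ.≤-refl (ℕ.m<m+n lo (s≤s z≤n)))
    (sum-cong-< (suc lo) l (λ i lo<i i<lo+1+l → f≈g i (ℕ.<⇒≤ lo<i) (≡.subst (i <_) (≡.sym (ℕ.+-suc lo l)) i<lo+1+l)))

  sum-const : ∀ lo l x → ∑ lo l (λ _ → x) ≡ l × x
  sum-const lo zero    x = ≡.refl
  sum-const lo (suc l) x = ≡.cong (x +_) (sum-const (suc lo) l x)

  sum-0 : ∀ lo l → ∑ lo l (λ _ → 0#) ≈ 0#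
  sum-0 lo zero    = refl
  sum-0 lo (suc l) = trans (+-identityˡ _) (sum-0 (suc lo) l)

  sum-shift : ∀ lo l (f : ℕ → Carrier) → ∑ (suc lo) l f ≡ ∑ lo l (λ i → f (suc i))
  sum-shift lo zero    f = ≡.refl
  sum-shift lo (suc l) f = ≡.cong (f (suc lo) +_) (sum-shift (suc lo) l f)

  sum-init-last : ∀ lo l (f : ℕ → Carrier) → ∑ lo (suc l) f ≈ ∑ lo l f + f (lo ℕ.+ l)
  sum-init-last lo zero    f = begin
    f lo + 0#        ≈⟨ +-comm (f lo) 0# ⟩
    0# + f lo        ≡⟨ ≡.cong (λ i → 0# + f i) (ℕ.+-identityʳ lo) ⟨
    0# + f (lo ℕ.+ 0) ∎
  sum-init-last lo (suc l) f = begin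
    f lo + ∑ (suc lo) (suc l) f                ≈⟨ +-congˡ (sum-init-last (suc lo) l f) ⟩
    f lo + (∑ (suc lo) l f + f (suc lo ℕ.+ l))  ≈⟨ +-assoc _ _ _ ⟨
    f lo + ∑ (suc lo) l f + f (suc lo ℕ.+ l)    ≡⟨ ≡.cong (λ i → f lo + ∑ (suc lo) l f + f i) (ℕ.+-suc lo l) ⟨
    f lo + ∑ (suc lo) l f + f (lo ℕ.+ suc l)    ∎

  sum-reverse : ∀ l (f : ℕ → Carrier) → ∑ 0 l f ≈ ∑ 0 l (λ j → f (l ∸ suc j))
  sum-reverse zero    f = refl
  sum-reverse (suc l) f = begin
    f 0 + ∑ 1 l f
      ≡⟨ ≡.cong (f 0 +_) (sum-shift 0 l f) ⟩
    f 0 + ∑ 0 l (λ j → f (suc j))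
      ≈⟨ +-congˡ (sum-reverse l (λ j → f (suc j))) ⟩
    f 0 + ∑ 0 l (λ j → f (suc (l ∸ suc j)))
      ≈⟨ +-comm _ _ ⟩
    ∑ 0 l (λ j → f (suc (l ∸ suc j))) + f 0
      ≈⟨ +-cong (sum-cong-< 0 l (λ j _ j<l → reflexive (≡.cong f (ℕ.+-∸-assoc 1 j<l))))
          (reflexive (≡.cong f (ℕ.n∸n≡0 l))) ⟨
    ∑ 0 l (λ j → f (suc l ∸ suc j)) + f (l ∸ l)
      ≈⟨ sum-init-last 0 l (λ j → f (suc l ∸ suc j)) ⟨
    ∑ 0 (suc l) (λ j → f (suc l ∸ suc j)) ∎

  sum-distrib-+ : ∀ lo l (f g : ℕ → Carrier) → ∑ lo l (λ i → f i + g i) ≈ ∑ lo l f + ∑ lo l g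
  sum-distrib-+ lo zero    f g = sym (+-identityˡ 0#)
  sum-distrib-+ lo (suc l) f g = begin
    (f lo + g lo) + ∑ (suc lo) l (λ i → f i + g i)     ≈⟨ +-congˡ (sum-distrib-+ (suc lo) l f g) ⟩
    (f lo + g lo) + (∑ (suc lo) l f + ∑ (suc lo) l g)  ≈⟨ interchange (f lo) (g lo) (∑ (suc lo) l f) (∑ (suc lo) l g) ⟩
    (f lo + ∑ (suc lo) l f) + (g lo + ∑ (suc lo) l g)  ∎

  *-distribˡ-sum : ∀ lo l a (f : ℕ → Carrier) → a * ∑ lo l f ≈ ∑ lo l (λ i → a * f i)
  *-distribˡ-sum lo zero    a f = zeroʳ a
  *-distribˡ-sum lo (suc l) a f = trans (distribˡ a (f lo) _) (+-congˡ (*-distribˡ-sum (suc lo) l a f))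

  *-distribʳ-sum : ∀ lo l a (f : ℕ → Carrier) → ∑ lo l f * a ≈ ∑ lo l (λ i → f i * a)
  *-distribʳ-sum lo l a f = trans (*-comm _ a) (trans (*-distribˡ-sum lo l a f) (sum-cong lo l (λ i → *-comm a (f i))))

  -‿distrib-sum : ∀ lo l (f : ℕ → Carrier) → - ∑ lo l f ≈ ∑ lo l (λ i → - f i)
  -‿distrib-sum lo l f = begin
    - ∑ lo l f                ≈⟨ -1*x≈-x _ ⟨
    - 1# * ∑ lo l f           ≈⟨ *-distribˡ-sum lo l (- 1#) f ⟩
    ∑ lo l (λ i → - 1# * f i) ≈⟨ sum-cong lo l (λ i → -1*x≈-x (f i)) ⟩
    ∑ lo l (λ i → - f i)      ∎

  pow≡^ : ∀ x k → pow R x k ≡ x ^ k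
  pow≡^ x zero    = ≡.refl
  pow≡^ x (suc k) = ≡.cong (x *_) (pow≡^ x k)

  x+y≈z⇒x≈z-y : ∀ {x y z} → x + y ≈ z → x ≈ z - y
  x+y≈z⇒x≈z-y {x} {y} {z} x+y≈z = begin
    x                ≈⟨ +-identityʳ x ⟨
    x + 0#           ≈⟨ +-congˡ (-‿inverseʳ y) ⟨
    x + (y - y)      ≈⟨ +-assoc x y (- y) ⟨
    (x + y) - y      ≈⟨ +-congʳ x+y≈z ⟩
    z - y            ∎

  x-y+y≈x : ∀ x y → x - y + y ≈ x
  x-y+y≈x x y = trans (+-assoc x (- y) y) (trans (+-congˡ (-‿inverseˡ y)) (+-identityʳ x))

  1^n≈1 : ∀ k → 1# ^ k ≈ 1#
  1^n≈1 zero    = refl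
  1^n≈1 (suc k) = trans (*-identityˡ _) (1^n≈1 k)

  ^-comm : ∀ x a b → (x ^ a) ^ b ≈ (x ^ b) ^ a
  ^-comm x a b = begin
    (x ^ a) ^ b     ≈⟨ ^-assocʳ x a b ⟩
    x ^ (a ℕ.* b)   ≡⟨ ≡.cong (x ^_) (ℕ.*-comm a b) ⟩
    x ^ (b ℕ.* a)   ≈⟨ ^-assocʳ x b a ⟨
    (x ^ b) ^ a     ∎

  *-cancelˡ-invertible : ∀ {d e x y} → e * d ≈ 1# → d * x ≈ d * y → x ≈ y
  *-cancelˡ-invertible {d} {e} {x} {y} ed≈1 dx≈dy = begin
    x              ≈⟨ *-identityˡ x ⟨
    1# * x         ≈⟨ *-congʳ ed≈1 ⟨
    e * d * x      ≈⟨ *-assoc e d x ⟩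
    e * (d * x)    ≈⟨ *-congˡ dx≈dy ⟩
    e * (d * y)    ≈⟨ *-assoc e d y ⟨
    e * d * y      ≈⟨ *-congʳ ed≈1 ⟩
    1# * y         ≈⟨ *-identityˡ y ⟩
    y              ∎

  [x^i]^n≈1 : ∀ {x} n → x ^ n ≈ 1# → ∀ i → (x ^ i) ^ n ≈ 1#
  [x^i]^n≈1 {x} n xⁿ≈1 i = trans (^-comm x i n) (trans (^-congˡ i xⁿ≈1) (1^n≈1 i))

module RootsOfUnity {c ℓ : Level} (R : CommutativeRing c ℓ) where
  open import Data.Nat as ℕ using (zero; suc; z≤n; s≤s)
  import Data.Nat.Properties as ℕ
  open CommutativeRing R
  open FiniteSums R public
  open import Algebra.Properties.Ring ring using (-0#≈0#; [y-z]x≈yx-zx; x[y-z]≈xy-xz)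
  open import Algebra.Solver.Ring.NaturalCoefficients.Default commutativeSemiring
    using (solve; _:+_; _:*_; _:=_; con)
  open import Relation.Binary.Reasoning.Setoid setoid

  horner : Carrier → (ℕ → Carrier) → ℕ → Carrier
  horner y c zero    = 0#
  horner y c (suc m) = y * horner y c m + c m

  horner-cong : ∀ y m {c d : ℕ → Carrier} → (∀ j → j < m → c j ≈ d j) → horner y c m ≈ horner y d m
  horner-cong y zero    c≈d = refl
  horner-cong y (suc m) c≈d = +-cong (*-congˡ (horner-cong y m (λ j j<m → c≈d j (ℕ.m<n⇒m<1+n j<m)))) (c≈d m ℕ.≤-refl)

  sum-horner : ∀ y lo l (a : ℕ → Carrier) (c : ℕ → ℕ → Carrier) m →
    ∑ lo l (λ i → a i * horner y (c i) m) ≈ horner y (λ j → ∑ lo l (λ i → a i * c i j)) m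
  sum-horner y lo l a c zero    = trans (sum-cong lo l (λ i → zeroʳ (a i))) (sum-0 lo l)
  sum-horner y lo l a c (suc m) = begin
    ∑ lo l (λ i → a i * (y * horner y (c i) m + c i m))
      ≈⟨ sum-cong lo l (λ i → distribute (a i) (horner y (c i) m) (c i m)) ⟩
    ∑ lo l (λ i → y * (a i * horner y (c i) m) + a i * c i m)
      ≈⟨ sum-distrib-+ lo l _ _ ⟩
    ∑ lo l (λ i → y * (a i * horner y (c i) m)) + ∑ lo l (λ i → a i * c i m)
      ≈⟨ +-congʳ (*-distribˡ-sum lo l y _) ⟨
    y * ∑ lo l (λ i → a i * horner y (c i) m) + ∑ lo l (λ i → a i * c i m)
      ≈⟨ +-congʳ (*-congˡ (sum-horner y lo l a c m)) ⟩
    y * horner y (λ j → ∑ lo l (λ i → a i * c i j)) m + ∑ lo l (λ i → a i * c i m) ∎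
    where
    distribute : ∀ a h c → a * (y * h + c) ≈ y * (a * h) + a * c
    distribute a h c = solve 4 (λ a y h c → a :* (y :* h :+ c) := y :* (a :* h) :+ a :* c) refl a y h c

  horner-1 : ∀ c m → horner 1# c m ≈ ∑ 0 m c
  horner-1 c zero    = refl
  horner-1 c (suc m) = trans (+-congʳ (trans (*-identityˡ _) (horner-1 c m))) (sym (sum-init-last 0 m c))

  -- y ^ m - z ^ m = (y - z) (y ^ (m - 1) + y ^ (m - 2) z + ... + z ^ (m - 1)), stated for any
  -- d with d + z ≈ y so that the induction involves no subtraction.
  horner-factor : ∀ {d y z} → d + z ≈ y → ∀ m → d * horner y (z ^_) m + z ^ m ≈ y ^ m
  horner-factor d+z≈y zero    = trans (+-congʳ (zeroʳ _)) (+-identityˡ 1#)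
  horner-factor {d} {y} {z} d+z≈y (suc m) = begin
    d * (y * H + z ^ m) + z * z ^ m
      ≈⟨ solve 5 (λ d y z h p → d :* (y :* h :+ p) :+ z :* p := y :* (d :* h) :+ (d :+ z) :* p) refl d y z H (z ^ m) ⟩
    y * (d * H) + (d + z) * z ^ m
      ≈⟨ +-congˡ (*-congʳ d+z≈y) ⟩
    y * (d * H) + y * z ^ m
      ≈⟨ distribˡ y (d * H) (z ^ m) ⟨
    y * (d * H + z ^ m)
      ≈⟨ *-congˡ (horner-factor d+z≈y m) ⟩
    y * y ^ m ∎
    where
    H : Carrier
    H = horner y (z ^_) m

  horner-telescope : ∀ y (t : ℕ → Carrier) m → (∀ j → 1 ≤ j → j ≤ m → t j ≈ 0#) →
    horner y (λ j → t j - t (suc j)) (suc m) ≈ y ^ m * t 0 - t (suc m)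
  horner-telescope y t zero    _  = trans (+-congʳ (zeroʳ y)) (trans (+-identityˡ _) (+-congʳ (sym (*-identityˡ (t 0)))))
  horner-telescope y t (suc m) t≈0 = begin
    y * horner y (λ j → t j - t (suc j)) (suc m) + (t (suc m) - t (suc (suc m)))
      ≈⟨ +-cong (*-congˡ (horner-telescope y t m (λ j 1≤j j≤m → t≈0 j 1≤j (ℕ.m≤n⇒m≤1+n j≤m)))) (+-congʳ tₘ≈0) ⟩
    y * (y ^ m * t 0 - t (suc m)) + (0# - t (suc (suc m)))
      ≈⟨ +-congʳ (*-congˡ (+-congˡ (trans (-‿cong tₘ≈0) -0#≈0#))) ⟩
    y * (y ^ m * t 0 + 0#) + (0# - t (suc (suc m)))
      ≈⟨ solve 4 (λ y p t u → y :* (p :* t :+ con 0) :+ (con 0 :+ u) := y :* p :* t :+ u) refl y (y ^ m) (t 0) (- t (suc (suc m))) ⟩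
    y * y ^ m * t 0 - t (suc (suc m)) ∎
    where
    tₘ≈0 : t (suc m) ≈ 0#
    tₘ≈0 = t≈0 (suc m) (s≤s z≤n) ℕ.≤-refl

  root-of-unity-sum : ∀ {x w} n → x ^ n ≈ 1# → w * (1# - x) ≈ 1# → ∑ 0 n (x ^_) ≈ 0#
  root-of-unity-sum {x} {w} n xⁿ≈1 w[1-x]≈1 = begin
    S                      ≈⟨ *-identityˡ S ⟨
    1# * S                 ≈⟨ *-congʳ w[1-x]≈1 ⟨
    w * (1# - x) * S       ≈⟨ *-assoc w (1# - x) S ⟩
    w * ((1# - x) * S)     ≈⟨ *-congˡ (x+y≈z⇒x≈z-y [1-x]S+1≈1) ⟩
    w * (1# - 1#)          ≈⟨ *-congˡ (-‿inverseʳ 1#) ⟩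
    w * 0#                 ≈⟨ zeroʳ w ⟩
    0#                     ∎
    where
    S : Carrier
    S = ∑ 0 n (x ^_)
    [1-x]S+1≈1 : (1# - x) * S + 1# ≈ 1#
    [1-x]S+1≈1 = begin
      (1# - x) * S + 1#                      ≈⟨ +-congˡ xⁿ≈1 ⟨
      (1# - x) * S + x ^ n                   ≈⟨ +-congʳ (*-congˡ (horner-1 (x ^_) n)) ⟨
      (1# - x) * horner 1# (x ^_) n + x ^ n  ≈⟨ horner-factor (x-y+y≈x 1# x) n ⟩
      1# ^ n                                 ≈⟨ 1^n≈1 n ⟩
      1#                                     ∎

  -- Exchanging the two sums gives Horner coefficients T j - T (j + 1) with T j = ∑ᵢ ζ^(i j),
  -- and T j is n for j ∈ {0, n} and 0 in between.
  partial-fractions : ∀ m {ζ} (w : ℕ → Carrier) → ζ ^ suc m ≈ 1# →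
    (∀ j → 1 ≤ j → j < suc m → w j * (1# - ζ ^ j) ≈ 1#) → ∀ y →
    ∑ 0 (suc m) (λ i → (1# - ζ ^ i) * horner y ((ζ ^ i) ^_) (suc m)) ≈ (suc m × 1#) * (y ^ m - 1#)
  partial-fractions m {ζ} w ζⁿ≈1 w-inverse y = begin
    ∑ 0 n (λ i → (1# - ζ ^ i) * horner y ((ζ ^ i) ^_) n)
      ≈⟨ sum-horner y 0 n (λ i → 1# - ζ ^ i) (λ i → (ζ ^ i) ^_) n ⟩
    horner y (λ j → ∑ 0 n (λ i → (1# - ζ ^ i) * (ζ ^ i) ^ j)) n
      ≈⟨ horner-cong y n (λ j _ → coefficient j) ⟩
    horner y (λ j → T j - T (suc j)) n
      ≈⟨ horner-telescope y T m (λ j 1≤j j≤m → T-vanishes j 1≤j (s≤s j≤m)) ⟩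
    y ^ m * T 0 - T n
      ≈⟨ +-cong (*-congˡ T₀≈n) (-‿cong Tₙ≈n) ⟩
    y ^ m * (n × 1#) - n × 1#
      ≈⟨ +-cong (*-comm _ _) (-‿cong (*-identityʳ _)) ⟨
    (n × 1#) * y ^ m - (n × 1#) * 1#
      ≈⟨ x[y-z]≈xy-xz (n × 1#) (y ^ m) 1# ⟨
    (n × 1#) * (y ^ m - 1#) ∎
    where
    n : ℕ
    n = suc m
    T : ℕ → Carrier
    T j = ∑ 0 n (λ i → (ζ ^ i) ^ j)
    T₀≈n : T 0 ≈ n × 1#
    T₀≈n = reflexive (sum-const 0 n 1#)
    Tₙ≈n : T n ≈ n × 1#
    Tₙ≈n = trans (sum-cong 0 n ([x^i]^n≈1 n ζⁿ≈1)) T₀≈n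
    coefficient : ∀ j → ∑ 0 n (λ i → (1# - ζ ^ i) * (ζ ^ i) ^ j) ≈ T j - T (suc j)
    coefficient j = begin
      ∑ 0 n (λ i → (1# - ζ ^ i) * (ζ ^ i) ^ j)
        ≈⟨ sum-cong 0 n (λ i → trans ([y-z]x≈yx-zx _ 1# (ζ ^ i)) (+-congʳ (*-identityˡ _))) ⟩
      ∑ 0 n (λ i → (ζ ^ i) ^ j - (ζ ^ i) ^ suc j)
        ≈⟨ sum-distrib-+ 0 n _ _ ⟩
      T j + ∑ 0 n (λ i → - (ζ ^ i) ^ suc j)
        ≈⟨ +-congˡ (-‿distrib-sum 0 n _) ⟨
      T j - T (suc j) ∎
    T-vanishes : ∀ j → 1 ≤ j → j < n → T j ≈ 0#
    T-vanishes j 1≤j j<n = trans (sum-cong 0 n (λ i → ^-comm ζ i j))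
      (root-of-unity-sum n ([x^i]^n≈1 n ζⁿ≈1 j) (w-inverse j 1≤j j<n))

module PowerSeries {c ℓ : Level} (R : CommutativeRing c ℓ) where
  open import Data.Nat as ℕ using (zero; suc)
  import Data.Nat.Properties as ℕ
  open import Data.Product using (_,_)
  open import Algebra.Structures using (IsCommutativeRing)
  import Algebra.Construct.Pointwise ℕ as Pointwise
  open CommutativeRing R
  open FiniteSums R
  open import Algebra.Properties.Ring ring using (-0#≈0#)
  open import Algebra.Solver.Ring.NaturalCoefficients.Default commutativeSemiring
    using (solve; _:+_; _:*_; _:=_)
  open import Relation.Binary.Reasoning.Setoid setoid

  Series : Set c
  Series = ℕ → Carrier

  infix  4 _≈ₛ_
  infixl 6 _+ₛ_
  infixl 7 _*ₛ_ _·ₛ_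
  infix  8 -ₛ_

  _≈ₛ_ : Series → Series → Set ℓ
  f ≈ₛ g = ∀ k → f k ≈ g k

  _+ₛ_ : Series → Series → Series
  (f +ₛ g) k = f k + g k

  -ₛ_ : Series → Series
  (-ₛ f) k = - f k

  _·ₛ_ : Carrier → Series → Series
  (a ·ₛ f) k = a * f k

  0ₛ : Series
  0ₛ _ = 0#

  cst : Carrier → Series
  cst a zero    = a
  cst a (suc _) = 0#

  1ₛ : Series
  1ₛ = cst 1#

  _*ₛ_ : Series → Series → Series
  (f *ₛ g) k = ∑ 0 (suc k) (λ j → f j * g (k ∸ j))

  tail : Series → Series
  tail f k = f (suc k)

  tail-*ₛ : ∀ f g → tail (f *ₛ g) ≈ₛ f 0 ·ₛ tail g +ₛ tail f *ₛ g
  tail-*ₛ f g k = +-congˡ (reflexive (sum-shift 0 (suc k) _))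

  *ₛ-cong : ∀ {f f′ g g′} → f ≈ₛ f′ → g ≈ₛ g′ → f *ₛ g ≈ₛ f′ *ₛ g′
  *ₛ-cong f≈f′ g≈g′ k = sum-cong 0 (suc k) (λ j → *-cong (f≈f′ j) (g≈g′ (k ∸ j)))

  *ₛ-distribʳ : ∀ h f g → (f +ₛ g) *ₛ h ≈ₛ f *ₛ h +ₛ g *ₛ h
  *ₛ-distribʳ h f g k = trans (sum-cong 0 (suc k) (λ j → distribʳ (h (k ∸ j)) (f j) (g j))) (sum-distrib-+ 0 (suc k) _ _)

  ·ₛ-*ₛ : ∀ a f g → (a ·ₛ f) *ₛ g ≈ₛ a ·ₛ (f *ₛ g)
  ·ₛ-*ₛ a f g k = trans (sum-cong 0 (suc k) (λ j → *-assoc a (f j) (g (k ∸ j)))) (sym (*-distribˡ-sum 0 (suc k) a _))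

  cst-*ₛ : ∀ a f → cst a *ₛ f ≈ₛ a ·ₛ f
  cst-*ₛ a f k = begin
    a * f (k ∸ 0) + ∑ 1 k (λ j → cst a j * f (k ∸ j))  ≡⟨ ≡.cong (a * f k +_) (sum-shift 0 k _) ⟩
    a * f k + ∑ 0 k (λ j → 0# * f (k ∸ suc j))         ≈⟨ +-congˡ (trans (sum-cong 0 k (λ j → zeroˡ _)) (sum-0 0 k)) ⟩
    a * f k + 0#                                       ≈⟨ +-identityʳ _ ⟩
    a * f k                                            ∎

  *ₛ-identityˡ : ∀ f → 1ₛ *ₛ f ≈ₛ f
  *ₛ-identityˡ f k = trans (cst-*ₛ 1# f k) (*-identityˡ (f k))

  *ₛ-comm : ∀ f g → f *ₛ g ≈ₛ g *ₛ f
  *ₛ-comm f g k = trans (sum-reverse (suc k) _)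
    (sum-cong-< 0 (suc k) (λ j _ j<1+k → trans (*-comm _ _) (*-congʳ (reflexive (≡.cong g (ℕ.m∸[m∸n]≡n (ℕ.≤-pred j<1+k)))))))

  *ₛ-assoc : ∀ f g h → (f *ₛ g) *ₛ h ≈ₛ f *ₛ (g *ₛ h)
  *ₛ-assoc f g h zero = +-congʳ (trans (*-congʳ (+-identityʳ _)) (trans (*-assoc _ _ _) (*-congˡ (sym (+-identityʳ _)))))
  *ₛ-assoc f g h (suc k) = begin
    ((f *ₛ g) *ₛ h) (suc k)
      ≈⟨ tail-*ₛ (f *ₛ g) h k ⟩
    (f *ₛ g) 0 * h (suc k) + (tail (f *ₛ g) *ₛ h) k
      ≈⟨ +-cong (*-congʳ (+-identityʳ _)) (*ₛ-cong {g = h} (tail-*ₛ f g) (λ _ → refl) k) ⟩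
    f 0 * g 0 * h (suc k) + ((f 0 ·ₛ tail g +ₛ tail f *ₛ g) *ₛ h) k
      ≈⟨ +-congˡ (trans (*ₛ-distribʳ h _ _ k) (+-cong (·ₛ-*ₛ (f 0) (tail g) h k) (*ₛ-assoc (tail f) g h k))) ⟩
    f 0 * g 0 * h (suc k) + (f 0 * (tail g *ₛ h) k + (tail f *ₛ (g *ₛ h)) k)
      ≈⟨ solve 5 (λ a b c d e → a :* b :* c :+ (a :* d :+ e) := a :* (b :* c :+ d) :+ e) refl
                 (f 0) (g 0) (h (suc k)) ((tail g *ₛ h) k) ((tail f *ₛ (g *ₛ h)) k) ⟩
    f 0 * (g 0 * h (suc k) + (tail g *ₛ h) k) + (tail f *ₛ (g *ₛ h)) k
      ≈⟨ +-congʳ (*-congˡ (tail-*ₛ g h k)) ⟨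
    f 0 * (g *ₛ h) (suc k) + (tail f *ₛ (g *ₛ h)) k
      ≈⟨ tail-*ₛ f (g *ₛ h) k ⟨
    (f *ₛ (g *ₛ h)) (suc k) ∎

  *ₛ-distribˡ : ∀ h f g → h *ₛ (f +ₛ g) ≈ₛ h *ₛ f +ₛ h *ₛ g
  *ₛ-distribˡ h f g k = begin
    (h *ₛ (f +ₛ g)) k          ≈⟨ *ₛ-comm h (f +ₛ g) k ⟩
    ((f +ₛ g) *ₛ h) k          ≈⟨ *ₛ-distribʳ h f g k ⟩
    (f *ₛ h) k + (g *ₛ h) k    ≈⟨ +-cong (*ₛ-comm f h k) (*ₛ-comm g h k) ⟩
    (h *ₛ f) k + (h *ₛ g) k    ∎

  +ₛ-*ₛ-isCommutativeRing : IsCommutativeRing _≈ₛ_ _+ₛ_ _*ₛ_ -ₛ_ 0ₛ 1ₛ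
  +ₛ-*ₛ-isCommutativeRing = record
    { isRing = record
      { +-isAbelianGroup = Pointwise.isAbelianGroup +-isAbelianGroup
      ; *-cong           = *ₛ-cong
      ; *-assoc          = *ₛ-assoc
      ; *-identity       = *ₛ-identityˡ , λ f k → trans (*ₛ-comm f 1ₛ k) (*ₛ-identityˡ f k)
      ; distrib          = *ₛ-distribˡ , *ₛ-distribʳ
      }
    ; *-comm = *ₛ-comm
    }

  powerSeriesRing : CommutativeRing c ℓ
  powerSeriesRing = record { isCommutativeRing = +ₛ-*ₛ-isCommutativeRing }

  module S = CommutativeRing powerSeriesRing
  open FiniteSums powerSeriesRing public using () renaming (_^_ to _^ₛ_; _×_ to _×ₛ_)

  cst-cong : ∀ {a b} → a ≈ b → cst a ≈ₛ cst b
  cst-cong a≈b zero    = a≈b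
  cst-cong a≈b (suc _) = refl

  cst-0 : cst 0# ≈ₛ 0ₛ
  cst-0 zero    = refl
  cst-0 (suc _) = refl

  cst-+ : ∀ a b → cst (a + b) ≈ₛ cst a +ₛ cst b
  cst-+ a b zero    = refl
  cst-+ a b (suc _) = sym (+-identityˡ 0#)

  cst-neg : ∀ a → cst (- a) ≈ₛ -ₛ cst a
  cst-neg a zero    = refl
  cst-neg a (suc _) = sym -0#≈0#

  cst-- : ∀ a b → cst (a - b) ≈ₛ cst a S.- cst b
  cst-- a b k = trans (cst-+ a (- b) k) (+-congˡ (cst-neg b k))

  cst-* : ∀ a b → cst (a * b) ≈ₛ cst a *ₛ cst b
  cst-* a b k = sym (trans (cst-*ₛ a (cst b) k) (a*cst[b]≈cst[ab] k))
    where
    a*cst[b]≈cst[ab] : ∀ k → a * cst b k ≈ cst (a * b) k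
    a*cst[b]≈cst[ab] zero    = refl
    a*cst[b]≈cst[ab] (suc _) = zeroʳ a

  cst-^ : ∀ a k → cst (a ^ k) ≈ₛ cst a ^ₛ k
  cst-^ a zero    = S.refl
  cst-^ a (suc k) = S.trans (cst-* a (a ^ k)) (*ₛ-cong S.refl (cst-^ a k))

  cst-× : ∀ k a → cst (k × a) ≈ₛ k ×ₛ cst a
  cst-× zero    a = cst-0
  cst-× (suc k) a = S.trans (cst-+ a (k × a)) (S.+-congˡ (cst-× k a))

  X : Series
  X zero    = 0#
  X (suc k) = 1ₛ k

  X-*ₛ-zero : ∀ f → (X *ₛ f) 0 ≈ 0#
  X-*ₛ-zero f = trans (+-identityʳ _) (zeroˡ (f 0))

  X-*ₛ-suc : ∀ f k → (X *ₛ f) (suc k) ≈ f k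
  X-*ₛ-suc f k = trans (tail-*ₛ X f k) (trans (+-cong (zeroˡ _) (*ₛ-identityˡ f k)) (+-identityˡ (f k)))

  geometric : Carrier → Series
  geometric a k = a ^ k

  geometric-inverse : ∀ a → (1ₛ S.- cst a *ₛ X) *ₛ geometric a ≈ₛ 1ₛ
  geometric-inverse a k = trans (distributed k) (coefficient k)
    where
    open import Algebra.Properties.Ring S.ring using ([y-z]x≈yx-zx)
    g : Series
    g = geometric a
    distributed : (1ₛ S.- cst a *ₛ X) *ₛ g ≈ₛ g S.- cst a *ₛ (X *ₛ g)
    distributed = S.trans ([y-z]x≈yx-zx g 1ₛ (cst a *ₛ X)) (S.+-cong (S.*-identityˡ g) (S.-‿cong (S.*-assoc (cst a) X g)))
    coefficient : ∀ k → g k - (cst a *ₛ (X *ₛ g)) k ≈ 1ₛ k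
    coefficient zero    = begin
      1# - (cst a *ₛ (X *ₛ g)) 0
        ≈⟨ +-congˡ (-‿cong (trans (cst-*ₛ a (X *ₛ g) 0) (trans (*-congˡ (X-*ₛ-zero g)) (zeroʳ a)))) ⟩
      1# - 0#
        ≈⟨ +-congˡ -0#≈0# ⟩
      1# + 0#
        ≈⟨ +-identityʳ 1# ⟩
      1# ∎
    coefficient (suc k) = begin
      a * a ^ k - (cst a *ₛ (X *ₛ g)) (suc k)
        ≈⟨ +-congˡ (-‿cong (trans (cst-*ₛ a (X *ₛ g) (suc k)) (*-congˡ (X-*ₛ-suc g k)))) ⟩
      a * a ^ k - a * a ^ k
        ≈⟨ -‿inverseʳ (a * a ^ k) ⟩
      0# ∎

  sum-coefficient : ∀ lo l (F : ℕ → Series) k → sumR powerSeriesRing lo l F k ≈ ∑ lo l (λ i → F i k)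
  sum-coefficient lo zero    F k = refl
  sum-coefficient lo (suc l) F k = +-congˡ (sum-coefficient (suc lo) l F k)

module ≈-Reasoning {c ℓ} (S : Setoid c ℓ) = Relation.Binary.Reasoning.Setoid S

module EGFSeries {c ℓ : Level} (R : CommutativeRing c ℓ) (ι : ℚ → CommutativeRing.Carrier R)
  (ι-hom : RingMorphisms.IsRingHomomorphism +-*-rawRing (CommutativeRing.rawRing R) ι) where
  open import Data.Nat as ℕ using (zero; suc; _!)
  import Data.Nat.Properties as ℕ
  open import Data.Nat.Combinatorics using (_C_)
  open import Data.Integer as ℤ using (+_)
  open import Data.Rational as ℚ using (0ℚ; 1ℚ; _/_)
  import Data.Rational.Properties as ℚ
  open CommutativeRing R
  open FiniteSums R
  open PowerSeries R
  open RationalArithmetic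
  open ExponentialGeneratingFunctions
  module ι = RingMorphisms.IsRingHomomorphism ι-hom

  ι-cong : ∀ {p q} → p ≡ q → ι p ≈ ι q
  ι-cong = ι.⟦⟧-cong

  ι-sumℚ : ∀ lo l f → ι (sumℚ lo l f) ≈ ∑ lo l (λ i → ι (f i))
  ι-sumℚ lo zero    f = ι.0#-homo
  ι-sumℚ lo (suc l) f = trans (ι.+-homo (f lo) (sumℚ (suc lo) l f)) (+-congˡ (ι-sumℚ (suc lo) l f))

  ι-ℕ→ℚ : ∀ n → ι (ℕ→ℚ n) ≈ n × 1#
  ι-ℕ→ℚ zero    = ι.0#-homo
  ι-ℕ→ℚ (suc n) = begin
    ι (ℕ→ℚ (suc n))        ≈⟨ ι-cong (ℕ→ℚ-suc n) ⟩
    ι (1ℚ ℚ.+ ℕ→ℚ n)       ≈⟨ ι.+-homo 1ℚ (ℕ→ℚ n) ⟩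
    ι 1ℚ + ι (ℕ→ℚ n)       ≈⟨ +-cong ι.1#-homo (ι-ℕ→ℚ n) ⟩
    1# + n × 1#            ∎
    where open ≈-Reasoning setoid

  ι-ℕ→ℚ-^ : ∀ a k → ι (ℕ→ℚ (a ℕ.^ k)) ≈ ι (ℕ→ℚ a) ^ k
  ι-ℕ→ℚ-^ a zero    = ι.1#-homo
  ι-ℕ→ℚ-^ a (suc k) = trans (ι-cong (ℕ→ℚ-homo-* a (a ℕ.^ k))) (trans (ι.*-homo _ _) (*-congˡ (ι-ℕ→ℚ-^ a k)))

  ι-[-1]^ : ∀ k → ι ((ℤ.- + 1) ℤ.^ k / 1) ≈ (- 1#) ^ k
  ι-[-1]^ zero    = ι.1#-homo
  ι-[-1]^ (suc k) = begin
    ι (((ℤ.- + 1) ℤ.* (ℤ.- + 1) ℤ.^ k) / 1)          ≡⟨ ≡.cong ι (/-*-/ (ℤ.- + 1) ((ℤ.- + 1) ℤ.^ k) 1 1) ⟨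
    ι ((ℤ.- + 1) / 1 ℚ.* ((ℤ.- + 1) ℤ.^ k / 1))      ≈⟨ ι.*-homo _ _ ⟩
    ι (ℚ.- 1ℚ) * ι ((ℤ.- + 1) ℤ.^ k / 1)             ≈⟨ *-cong (trans (ι.-‿homo 1ℚ) (-‿cong ι.1#-homo)) (ι-[-1]^ k) ⟩
    - 1# * (- 1#) ^ k                                ∎
    where open ≈-Reasoning setoid

  series : EGF → Series
  series a k = ι (a k ℚ.* 1/[ k !])

  series-1ₑ : series 1ₑ ≈ₛ 1ₛ
  series-1ₑ zero    = ι.1#-homo
  series-1ₑ (suc k) = trans (ι-cong (ℚ.*-zeroˡ 1/[ suc k !])) ι.0#-homo

  series-·ₑ : ∀ a b → series (a ·ₑ b) ≈ₛ series a *ₛ series b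
  series-·ₑ a b K = begin
    ι ((a ·ₑ b) K ℚ.* 1/[ K !])
      ≈⟨ ι.*-homo ((a ·ₑ b) K) 1/[ K !] ⟩
    ι ((a ·ₑ b) K) * ι 1/[ K !]
      ≈⟨ *-congʳ (ι-sumℚ 0 (suc K) term) ⟩
    ∑ 0 (suc K) (λ j → ι (term j)) * ι 1/[ K !]
      ≈⟨ *-distribʳ-sum 0 (suc K) (ι 1/[ K !]) _ ⟩
    ∑ 0 (suc K) (λ j → ι (term j) * ι 1/[ K !])
      ≈⟨ sum-cong-< 0 (suc K) (λ j _ j<1+K → coefficient j (ℕ.≤-pred j<1+K)) ⟩
    ∑ 0 (suc K) (λ j → series a j * series b (K ∸ j)) ∎
    where
    open ≈-Reasoning setoid
    term : ℕ → ℚ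
    term j = ℕ→ℚ (K C j) ℚ.* a j ℚ.* b (K ∸ j)
    coefficient : ∀ j → j ≤ K → ι (term j) * ι 1/[ K !] ≈ series a j * series b (K ∸ j)
    coefficient j j≤K = begin
      ι (term j) * ι 1/[ K !]                   ≈⟨ ι.*-homo (term j) 1/[ K !] ⟨
      ι (term j ℚ.* 1/[ K !])                   ≈⟨ ι-cong (·ₑ-coefficient j≤K (a j) (b (K ∸ j))) ⟩
      ι (a j ℚ.* 1/[ j !] ℚ.* (b (K ∸ j) ℚ.* 1/[ K ∸ j !])) ≈⟨ ι.*-homo _ _ ⟩
      series a j * series b (K ∸ j)             ∎

  series-invₑ : ∀ a → a 0 ≡ 1ℚ → series a *ₛ series (invₑ a) ≈ₛ 1ₛ
  series-invₑ a a₀≡1 k = begin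
    (series a *ₛ series (invₑ a)) k   ≈⟨ series-·ₑ a (invₑ a) k ⟨
    series (a ·ₑ invₑ a) k            ≈⟨ ι-cong (≡.cong (ℚ._* 1/[ k !]) (·ₑ-invₑ a a₀≡1 k)) ⟩
    series 1ₑ k                       ≈⟨ series-1ₑ k ⟩
    1ₛ k                              ∎
    where open ≈-Reasoning setoid

  1+λt : ℚ → Series
  1+λt λ′ = 1ₛ +ₛ cst (ι λ′) *ₛ X

  series-binomλ-+λ : ∀ λ′ x → series (binomλ λ′ (x ℚ.+ λ′)) ≈ₛ 1+λt λ′ *ₛ series (binomλ λ′ x)
  series-binomλ-+λ λ′ x k = sym (trans (expand k) (coefficient k))
    where
    open ≈-Reasoning setoid
    F : Series
    F = series (binomλ λ′ x)
    expand : 1+λt λ′ *ₛ F ≈ₛ F +ₛ ι λ′ ·ₛ (X *ₛ F)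
    expand = S.trans (*ₛ-distribʳ F 1ₛ _) (S.+-cong (*ₛ-identityˡ F) (S.trans (*ₛ-assoc _ X F) (cst-*ₛ (ι λ′) (X *ₛ F))))
    coefficient : ∀ k → F k + ι λ′ * (X *ₛ F) k ≈ series (binomλ λ′ (x ℚ.+ λ′)) k
    coefficient zero    = trans (+-congˡ (trans (*-congˡ (X-*ₛ-zero F)) (zeroʳ _))) (+-identityʳ _)
    coefficient (suc k) = begin
      F (suc k) + ι λ′ * (X *ₛ F) (suc k)   ≈⟨ +-congˡ (*-congˡ (X-*ₛ-suc F k)) ⟩
      F (suc k) + ι λ′ * F k                ≈⟨ +-congˡ (ι.*-homo λ′ _) ⟨
      F (suc k) + ι (λ′ ℚ.* (binomλ λ′ x k ℚ.* 1/[ k !])) ≈⟨ ι.+-homo _ _ ⟨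
      ι (binomλ λ′ x (suc k) ℚ.* 1/[ suc k !] ℚ.+ λ′ ℚ.* (binomλ λ′ x k ℚ.* 1/[ k !]))
                                            ≈⟨ ι-cong (binomλ-+λ-coefficient λ′ x k) ⟨
      series (binomλ λ′ (x ℚ.+ λ′)) (suc k) ∎

  series-binomλ-cong : ∀ λ′ {x y} → x ≡ y → series (binomλ λ′ x) ≈ₛ series (binomλ λ′ y)
  series-binomλ-cong λ′ x≡y k = ι-cong (≡.cong (λ x → fallingλ x λ′ k ℚ.* 1/[ k !]) x≡y)

  series-binomλ-ℕ : ∀ λ′ N → series (binomλ λ′ (ℕ→ℚ N ℚ.* λ′)) ≈ₛ 1+λt λ′ ^ₛ N
  series-binomλ-ℕ λ′ zero    = S.trans (series-binomλ-cong λ′ (ℚ.*-zeroˡ λ′)) series-binomλ-0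
    where
    series-binomλ-0 : series (binomλ λ′ 0ℚ) ≈ₛ 1ₛ
    series-binomλ-0 zero    = ι.1#-homo
    series-binomλ-0 (suc k) =
      trans (ι-cong (≡.trans (≡.cong (ℚ._* 1/[ suc k !]) (fallingλ-zero λ′ k)) (ℚ.*-zeroˡ 1/[ suc k !]))) ι.0#-homo
  series-binomλ-ℕ λ′ (suc N) k = begin
    series (binomλ λ′ (ℕ→ℚ (suc N) ℚ.* λ′)) k
      ≈⟨ series-binomλ-cong λ′ (ℕ→ℚ-suc-* N λ′) k ⟩
    series (binomλ λ′ (ℕ→ℚ N ℚ.* λ′ ℚ.+ λ′)) k
      ≈⟨ series-binomλ-+λ λ′ (ℕ→ℚ N ℚ.* λ′) k ⟩
    (1+λt λ′ *ₛ series (binomλ λ′ (ℕ→ℚ N ℚ.* λ′))) k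
      ≈⟨ *ₛ-cong S.refl (series-binomλ-ℕ λ′ N) k ⟩
    (1+λt λ′ *ₛ 1+λt λ′ ^ₛ N) k ∎
    where open ≈-Reasoning setoid

  X-*ₛ-series-denomλ : ∀ λ′ → X *ₛ series (denomλ λ′) ≈ₛ series (binomλ λ′ 1ℚ) S.- 1ₛ
  X-*ₛ-series-denomλ λ′ zero    = trans (X-*ₛ-zero (series (denomλ λ′))) (sym (trans (+-congʳ ι.1#-homo) (-‿inverseʳ 1#)))
  X-*ₛ-series-denomλ λ′ (suc k) = begin
    (X *ₛ series (denomλ λ′)) (suc k)         ≈⟨ X-*ₛ-suc (series (denomλ λ′)) k ⟩
    ι (denomλ λ′ k ℚ.* 1/[ k !])              ≈⟨ ι-cong (denomλ-coefficient λ′ k) ⟩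
    series (binomλ λ′ 1ℚ) (suc k)             ≈⟨ +-identityʳ _ ⟨
    series (binomλ λ′ 1ℚ) (suc k) + 0#        ≈⟨ +-congˡ -0#≈0# ⟨
    series (binomλ λ′ 1ℚ) (suc k) - 0#        ∎
    where
    open ≈-Reasoning setoid
    open import Algebra.Properties.Ring ring using (-0#≈0#)

  series-denomλ-*ₛ-β : ∀ λ′ x → series (denomλ λ′) *ₛ series (λ k → β k x λ′) ≈ₛ series (binomλ λ′ x)
  series-denomλ-*ₛ-β λ′ x = begin
    D *ₛ series (invₑ (denomλ λ′) ·ₑ binomλ λ′ x)  ≈⟨ *ₛ-cong S.refl (series-·ₑ (invₑ (denomλ λ′)) (binomλ λ′ x)) ⟩
    D *ₛ (D⁻¹ *ₛ B)                                ≈⟨ *ₛ-assoc D D⁻¹ B ⟨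
    (D *ₛ D⁻¹) *ₛ B                                ≈⟨ *ₛ-cong (series-invₑ (denomλ λ′) (denomλ-0 λ′)) S.refl ⟩
    1ₛ *ₛ B                                        ≈⟨ *ₛ-identityˡ B ⟩
    B                                              ∎
    where
    open ≈-Reasoning S.setoid
    D D⁻¹ B : Series
    D = series (denomλ λ′)
    D⁻¹ = series (invₑ (denomλ λ′))
    B = series (binomλ λ′ x)

module BernoulliSum {c ℓ : Level} (R : CommutativeRing c ℓ) (ι : ℚ → CommutativeRing.Carrier R)
  (ι-hom : RingMorphisms.IsRingHomomorphism +-*-rawRing (CommutativeRing.rawRing R) ι) (m : ℕ) where
  open import Data.Nat as ℕ using (suc; _!)
  open import Data.Nat.Properties using (_!≢0)
  open import Data.Integer as ℤ using (+_)
  open import Data.Rational as ℚ using (0ℚ; _/_)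
  import Data.Rational.Properties as ℚ
  import Algebra.Properties.Ring as RingProperties
  open CommutativeRing R
  open FiniteSums R
  open PowerSeries R
  open EGFSeries R ι ι-hom
  open RationalArithmetic
  open ExponentialGeneratingFunctions using (denomλ-0)
  open RingProperties ring using (-‿distribˡ-*; -‿distribʳ-*; -‿involutive; -1*x≈-x)
  open import Algebra.Solver.Ring.NaturalCoefficients.Default commutativeSemiring using (solve; _:*_; _:=_)
  module Sₛ = RootsOfUnity powerSeriesRing
  module Sᴾ = RingProperties S.ring
  open import Algebra.Properties.CommutativeSemigroup S.+-commutativeSemigroup using (xy∙z≈xz∙y)
  open import Algebra.Properties.CommutativeSemigroup S.*-commutativeSemigroup using (x∙yz≈y∙xz)
    renaming (xy∙z≈xz∙y to xy*z≈xz*y)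

  n : ℕ
  n = suc m

  λₙ : ℚ
  λₙ = + 1 / n

  Y : Series
  Y = 1+λt λₙ

  D : Series
  D = series (denomλ λₙ)

  δβ : ℕ → ℚ
  δβ k = β k (+ m / n) λₙ ℚ.- β k 0ℚ λₙ

  Δ : Series
  Δ = series (λ k → β k (+ m / n) λₙ) S.- series (λ k → β k 0ℚ λₙ)

  X*D≈Yⁿ-1 : X *ₛ D ≈ₛ Y ^ₛ n S.- 1ₛ
  X*D≈Yⁿ-1 = S.trans (X-*ₛ-series-denomλ λₙ)
    (S.+-congʳ (S.trans (series-binomλ-cong λₙ (≡.sym (ℕ→ℚ-*-inverse n))) (series-binomλ-ℕ λₙ n)))

  D*Δ≈Yᵐ-1 : D *ₛ Δ ≈ₛ Y ^ₛ m S.- 1ₛ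
  D*Δ≈Yᵐ-1 = begin
    D *ₛ Δ
      ≈⟨ Sᴾ.x[y-z]≈xy-xz D _ _ ⟩
    D *ₛ series (λ k → β k x₁ λₙ) S.- D *ₛ series (λ k → β k 0ℚ λₙ)
      ≈⟨ S.+-cong (series-denomλ-*ₛ-β λₙ x₁) (S.-‿cong (series-denomλ-*ₛ-β λₙ 0ℚ)) ⟩
    series (binomλ λₙ x₁) S.- series (binomλ λₙ 0ℚ)
      ≈⟨ S.+-cong (S.trans (series-binomλ-cong λₙ (/-as-* (+ m) n)) (series-binomλ-ℕ λₙ m))
                  (S.-‿cong (S.trans (series-binomλ-cong λₙ 0≡0λ) (series-binomλ-ℕ λₙ 0))) ⟩
    Y ^ₛ m S.- 1ₛ ∎
    where
    open ≈-Reasoning S.setoid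
    x₁ : ℚ
    x₁ = + m / n
    0≡0λ : 0ℚ ≡ ℕ→ℚ 0 ℚ.* λₙ
    0≡0λ = ≡.sym (ℚ.*-zeroˡ λₙ)

  Δ-coefficient : ∀ k → Δ k ≈ ι (δβ k) * ι 1/[ k !]
  Δ-coefficient k = begin
    ι (β₁ ℚ.* J) - ι (β₀ ℚ.* J)         ≈⟨ +-congˡ (ι.-‿homo (β₀ ℚ.* J)) ⟨
    ι (β₁ ℚ.* J) + ι (ℚ.- (β₀ ℚ.* J))   ≈⟨ ι.+-homo (β₁ ℚ.* J) (ℚ.- (β₀ ℚ.* J)) ⟨
    ι (β₁ ℚ.* J ℚ.- β₀ ℚ.* J)           ≈⟨ ι-cong (RingProperties.[y-z]x≈yx-zx ℚ.+-*-ring J β₁ β₀) ⟨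
    ι (δβ k ℚ.* J)                      ≈⟨ ι.*-homo (δβ k) J ⟩
    ι (δβ k) * ι J                      ∎
    where
    open ≈-Reasoning setoid
    β₁ β₀ J : ℚ
    β₁ = β k (+ m / n) λₙ
    β₀ = β k 0ℚ λₙ
    J = 1/[ k !]

  N : Carrier
  N = ι (ℕ→ℚ n)

  ι-rhs : ∀ s → ι (rhs n s) ≈ (- N) ^ s * N * ι 1/[ suc s !] * ι (δβ (suc s))
  ι-rhs s = trans (ι.*-homo coefficient (δβ (suc s))) (*-congʳ (begin
    ι coefficient
      ≈⟨ ι-cong coefficient≡ ⟩
    ι (sign / 1 ℚ.* ℕ→ℚ (n ℕ.^ suc s) ℚ.* J)
      ≈⟨ trans (ι.*-homo _ J) (*-congʳ (ι.*-homo _ _)) ⟩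
    ι (sign / 1) * ι (ℕ→ℚ (n ℕ.^ suc s)) * ι J
      ≈⟨ *-congʳ (*-cong (ι-[-1]^ s) (ι-ℕ→ℚ-^ n (suc s))) ⟩
    (- 1#) ^ s * (N * N ^ s) * ι J
      ≈⟨ *-congʳ (solve 3 (λ a b c → a :* (b :* c) := a :* c :* b) refl ((- 1#) ^ s) N (N ^ s)) ⟩
    (- 1#) ^ s * N ^ s * N * ι J
      ≈⟨ *-congʳ (*-congʳ (trans (sym (^-distrib-* (- 1#) N s)) (^-congˡ s (-1*x≈-x N)))) ⟩
    (- N) ^ s * N * ι J ∎))
    where
    open ≈-Reasoning setoid
    sign : ℤ.ℤ
    sign = (ℤ.- + 1) ℤ.^ s
    J : ℚ
    J = 1/[ suc s !]
    coefficient : ℚ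
    coefficient = ((sign ℤ.* + (n ℕ.^ suc s)) / (suc s !)) {{suc s !≢0}}
    coefficient≡ : coefficient ≡ sign / 1 ℚ.* ℕ→ℚ (n ℕ.^ suc s) ℚ.* J
    coefficient≡ = ≡.trans (/-as-* (sign ℤ.* + (n ℕ.^ suc s)) (suc s !) {{suc s !≢0}})
                           (≡.cong (ℚ._* J) (≡.sym (/-*-/ sign (+ (n ℕ.^ suc s)) 1 1)))

  module _ {ζ : Carrier} {w : ℕ → Carrier} (ζⁿ≈1 : ζ ^ n ≈ 1#)
           (w-inverse : ∀ i → 1 ≤ i → i < n → w i * (1# - ζ ^ i) ≈ 1#) where

    u : Carrier
    u = ι λₙ

    v : ℕ → Carrier
    v i = - (u * w i)

    -- H = ∑ᵢ 1/(1 + λₙ wᵢ t), whose coefficient of tˢ is ∑ᵢ (- λₙ wᵢ)ˢ.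
    H : Series
    H = sumR powerSeriesRing 1 m (λ i → geometric (v i))

    ζₛ : Series
    ζₛ = cst ζ

    ζₛⁿ≈1 : ζₛ ^ₛ n ≈ₛ 1ₛ
    ζₛⁿ≈1 = S.trans (S.sym (cst-^ ζ n)) (cst-cong ζⁿ≈1)

    1-ζₛⁱ≈cst : ∀ i → 1ₛ S.- ζₛ ^ₛ i ≈ₛ cst (1# - ζ ^ i)
    1-ζₛⁱ≈cst i = S.sym (S.trans (cst-- 1# (ζ ^ i)) (S.+-congˡ (S.-‿cong (cst-^ ζ i))))

    [1-ζⁱ]vᵢ≈-u : ∀ i → 1 ≤ i → i < n → (1# - ζ ^ i) * v i ≈ - u
    [1-ζⁱ]vᵢ≈-u i 1≤i i<n = begin
      (1# - ζ ^ i) * - (u * w i)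
        ≈⟨ -‿distribʳ-* _ _ ⟨
      - ((1# - ζ ^ i) * (u * w i))
        ≈⟨ -‿cong (trans (*-comm _ _) (trans (*-assoc u (w i) _) (*-congˡ (w-inverse i 1≤i i<n)))) ⟩
      - (u * 1#)
        ≈⟨ -‿cong (*-identityʳ u) ⟩
      - u ∎
      where open ≈-Reasoning setoid

    Y-ζⁱ≈[1-ζⁱ][1-vᵢt] : ∀ i → 1 ≤ i → i < n →
      Y S.- ζₛ ^ₛ i ≈ₛ (1ₛ S.- ζₛ ^ₛ i) *ₛ (1ₛ S.- cst (v i) *ₛ X)
    Y-ζⁱ≈[1-ζⁱ][1-vᵢt] i 1≤i i<n = S.sym (begin
      d *ₛ (1ₛ S.- cst (v i) *ₛ X)          ≈⟨ Sᴾ.x[y-z]≈xy-xz d 1ₛ _ ⟩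
      d *ₛ 1ₛ S.- d *ₛ (cst (v i) *ₛ X)     ≈⟨ S.+-cong (S.*-identityʳ d) (S.-‿cong (S.sym (S.*-assoc d (cst (v i)) X))) ⟩
      d S.- d *ₛ cst (v i) *ₛ X             ≈⟨ S.+-congˡ (S.-‿cong (S.*-congʳ d*vᵢ≈-u)) ⟩
      d S.- (S.- cst u) *ₛ X                ≈⟨ S.+-congˡ (S.-‿cong (S.sym (Sᴾ.-‿distribˡ-* (cst u) X))) ⟩
      d S.- S.- (cst u *ₛ X)                ≈⟨ S.+-congˡ (Sᴾ.-‿involutive _) ⟩
      d S.+ cst u *ₛ X                      ≈⟨ xy∙z≈xz∙y 1ₛ (S.- ζₛ ^ₛ i) (cst u *ₛ X) ⟩
      Y S.- ζₛ ^ₛ i                         ∎)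
      where
      open ≈-Reasoning S.setoid
      d : Series
      d = 1ₛ S.- ζₛ ^ₛ i
      d*vᵢ≈-u : d *ₛ cst (v i) ≈ₛ S.- cst u
      d*vᵢ≈-u = S.trans (S.*-congʳ (1-ζₛⁱ≈cst i))
        (S.trans (S.sym (cst-* _ _)) (S.trans (cst-cong ([1-ζⁱ]vᵢ≈-u i 1≤i i<n)) (cst-neg u)))

    [Yⁿ-1]gᵢ≈[1-ζⁱ]Qᵢ : ∀ i → 1 ≤ i → i < n →
      (Y ^ₛ n S.- 1ₛ) *ₛ geometric (v i) ≈ₛ (1ₛ S.- ζₛ ^ₛ i) *ₛ Sₛ.horner Y ((ζₛ ^ₛ i) ^ₛ_) n
    [Yⁿ-1]gᵢ≈[1-ζⁱ]Qᵢ i 1≤i i<n = begin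
      (Y ^ₛ n S.- 1ₛ) *ₛ g         ≈⟨ S.*-congʳ [Y-z]Q≈Yⁿ-1 ⟨
      (Y S.- z) *ₛ Q *ₛ g          ≈⟨ S.*-congʳ (S.*-congʳ (Y-ζⁱ≈[1-ζⁱ][1-vᵢt] i 1≤i i<n)) ⟩
      (1ₛ S.- z) *ₛ e *ₛ Q *ₛ g    ≈⟨ S.*-congʳ (xy*z≈xz*y (1ₛ S.- z) e Q) ⟩
      (1ₛ S.- z) *ₛ Q *ₛ e *ₛ g    ≈⟨ S.*-assoc _ e g ⟩
      (1ₛ S.- z) *ₛ Q *ₛ (e *ₛ g)  ≈⟨ S.*-congˡ (geometric-inverse (v i)) ⟩
      (1ₛ S.- z) *ₛ Q *ₛ 1ₛ        ≈⟨ S.*-identityʳ _ ⟩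
      (1ₛ S.- z) *ₛ Q              ∎
      where
      open ≈-Reasoning S.setoid
      z g e Q : Series
      z = ζₛ ^ₛ i
      g = geometric (v i)
      e = 1ₛ S.- cst (v i) *ₛ X
      Q = Sₛ.horner Y (z ^ₛ_) n
      [Y-z]Q≈Yⁿ-1 : (Y S.- z) *ₛ Q ≈ₛ Y ^ₛ n S.- 1ₛ
      [Y-z]Q≈Yⁿ-1 = Sₛ.x+y≈z⇒x≈z-y
        (S.trans (S.+-congˡ (S.sym (Sₛ.[x^i]^n≈1 n ζₛⁿ≈1 i))) (Sₛ.horner-factor (Sₛ.x-y+y≈x Y z) n))

    [Yⁿ-1]H≈n[Yᵐ-1] : (Y ^ₛ n S.- 1ₛ) *ₛ H ≈ₛ (n ×ₛ 1ₛ) *ₛ (Y ^ₛ m S.- 1ₛ)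
    [Yⁿ-1]H≈n[Yᵐ-1] = begin
      (Y ^ₛ n S.- 1ₛ) *ₛ H
        ≈⟨ Sₛ.*-distribˡ-sum 1 m _ _ ⟩
      Sₛ.∑ 1 m (λ i → (Y ^ₛ n S.- 1ₛ) *ₛ geometric (v i))
        ≈⟨ Sₛ.sum-cong-< 1 m [Yⁿ-1]gᵢ≈[1-ζⁱ]Qᵢ ⟩
      Sₛ.∑ 1 m term
        ≈⟨ S.trans (S.+-congʳ term₀≈0) (S.+-identityˡ _) ⟨
      Sₛ.∑ 0 n term
        ≈⟨ Sₛ.partial-fractions m (λ j → cst (w j)) ζₛⁿ≈1 w-inverseₛ Y ⟩
      (n ×ₛ 1ₛ) *ₛ (Y ^ₛ m S.- 1ₛ) ∎
      where
      open ≈-Reasoning S.setoid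
      term : ℕ → Series
      term i = (1ₛ S.- ζₛ ^ₛ i) *ₛ Sₛ.horner Y ((ζₛ ^ₛ i) ^ₛ_) n
      term₀≈0 : term 0 ≈ₛ 0ₛ
      term₀≈0 = S.trans (S.*-congʳ (S.-‿inverseʳ 1ₛ)) (S.zeroˡ _)
      w-inverseₛ : ∀ j → 1 ≤ j → j < n → cst (w j) *ₛ (1ₛ S.- ζₛ ^ₛ j) ≈ₛ 1ₛ
      w-inverseₛ j 1≤j j<n = S.trans (*ₛ-cong S.refl (1-ζₛⁱ≈cst j))
        (S.trans (S.sym (cst-* _ _)) (cst-cong (w-inverse j 1≤j j<n)))

    XH≈nΔ : X *ₛ H ≈ₛ (n ×ₛ 1ₛ) *ₛ Δ
    XH≈nΔ = Sₛ.*-cancelˡ-invertible D⁻¹D≈1 (begin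
      D *ₛ (X *ₛ H)                   ≈⟨ S.*-assoc D X H ⟨
      D *ₛ X *ₛ H                     ≈⟨ S.*-congʳ (S.*-comm D X) ⟩
      X *ₛ D *ₛ H                     ≈⟨ S.*-congʳ X*D≈Yⁿ-1 ⟩
      (Y ^ₛ n S.- 1ₛ) *ₛ H            ≈⟨ [Yⁿ-1]H≈n[Yᵐ-1] ⟩
      (n ×ₛ 1ₛ) *ₛ (Y ^ₛ m S.- 1ₛ)    ≈⟨ S.*-congˡ D*Δ≈Yᵐ-1 ⟨
      (n ×ₛ 1ₛ) *ₛ (D *ₛ Δ)           ≈⟨ x∙yz≈y∙xz (n ×ₛ 1ₛ) D Δ ⟩
      D *ₛ ((n ×ₛ 1ₛ) *ₛ Δ)           ∎)
      where
      open ≈-Reasoning S.setoid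
      D⁻¹D≈1 : series (invₑ (denomλ λₙ)) *ₛ D ≈ₛ 1ₛ
      D⁻¹D≈1 = S.trans (S.*-comm _ D) (series-invₑ (denomλ λₙ) (denomλ-0 λₙ))

    ∑vᵢˢ≈nΔ₁₊ₛ : ∀ s → ∑ 1 m (λ i → v i ^ s) ≈ (n × 1#) * Δ (suc s)
    ∑vᵢˢ≈nΔ₁₊ₛ s = begin
      ∑ 1 m (λ i → v i ^ s)           ≈⟨ sum-coefficient 1 m (λ i → geometric (v i)) s ⟨
      H s                             ≈⟨ X-*ₛ-suc H s ⟨
      (X *ₛ H) (suc s)                ≈⟨ XH≈nΔ (suc s) ⟩
      ((n ×ₛ 1ₛ) *ₛ Δ) (suc s)        ≈⟨ *ₛ-cong {g = Δ} (S.sym (cst-× n 1#)) S.refl (suc s) ⟩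
      (cst (n × 1#) *ₛ Δ) (suc s)     ≈⟨ cst-*ₛ (n × 1#) Δ (suc s) ⟩
      (n × 1#) * Δ (suc s)            ∎
      where open ≈-Reasoning setoid

    [-N]ˢ[-u]ˢ≈1 : ∀ s → (- N) ^ s * (- u) ^ s ≈ 1#
    [-N]ˢ[-u]ˢ≈1 s = begin
      (- N) ^ s * (- u) ^ s
        ≈⟨ ^-distrib-* (- N) (- u) s ⟨
      (- N * - u) ^ s
        ≈⟨ ^-congˡ s (trans (sym (-‿distribˡ-* N (- u))) (trans (-‿cong (sym (-‿distribʳ-* N u))) (-‿involutive (N * u)))) ⟩
      (N * u) ^ s
        ≈⟨ ^-congˡ s (trans (sym (ι.*-homo (ℕ→ℚ n) λₙ)) (trans (ι-cong (ℕ→ℚ-*-inverse n)) ι.1#-homo)) ⟩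
      1# ^ s
        ≈⟨ 1^n≈1 s ⟩
      1# ∎
      where open ≈-Reasoning setoid

    ∑wᵢˢ≈ι-rhs : ∀ s → ∑ 1 m (λ i → w i ^ s) ≈ ι (rhs n s)
    ∑wᵢˢ≈ι-rhs s = begin
      ∑ 1 m (λ i → w i ^ s)
        ≈⟨ *-identityˡ _ ⟨
      1# * ∑ 1 m (λ i → w i ^ s)
        ≈⟨ *-congʳ ([-N]ˢ[-u]ˢ≈1 s) ⟨
      (- N) ^ s * (- u) ^ s * ∑ 1 m (λ i → w i ^ s)
        ≈⟨ *-assoc _ _ _ ⟩
      (- N) ^ s * ((- u) ^ s * ∑ 1 m (λ i → w i ^ s))
        ≈⟨ *-congˡ [-u]ˢ∑wᵢˢ≈∑vᵢˢ ⟩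
      (- N) ^ s * ∑ 1 m (λ i → v i ^ s)
        ≈⟨ *-congˡ (∑vᵢˢ≈nΔ₁₊ₛ s) ⟩
      (- N) ^ s * ((n × 1#) * Δ (suc s))
        ≈⟨ *-congˡ (*-cong (ι-ℕ→ℚ n) (sym (Δ-coefficient (suc s)))) ⟨
      (- N) ^ s * (N * (ι (δβ (suc s)) * I))
        ≈⟨ solve 4 (λ a b c d → a :* (b :* (c :* d)) := a :* b :* d :* c) refl ((- N) ^ s) N (ι (δβ (suc s))) I ⟩
      (- N) ^ s * N * I * ι (δβ (suc s))
        ≈⟨ ι-rhs s ⟨
      ι (rhs n s) ∎
      where
      open ≈-Reasoning setoid
      I : Carrier
      I = ι 1/[ suc s !]
      [-u]ˢ∑wᵢˢ≈∑vᵢˢ : (- u) ^ s * ∑ 1 m (λ i → w i ^ s) ≈ ∑ 1 m (λ i → v i ^ s)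
      [-u]ˢ∑wᵢˢ≈∑vᵢˢ = trans (*-distribˡ-sum 1 m ((- u) ^ s) _)
        (sum-cong 1 m (λ i → trans (sym (^-distrib-* (- u) (w i) s)) (^-congˡ s (sym (-‿distribˡ-* u (w i))))))

theorem3 : {c ℓ : Level} (R : CommutativeRing c ℓ)
    → (ι : ℚ → CommutativeRing.Carrier R)
    → RingMorphisms.IsRingHomomorphism +-*-rawRing (CommutativeRing.rawRing R) ι
    → (n s : ℕ) → .{{_ : NonZero n}} → 1 ≤ s
    → (ζ : CommutativeRing.Carrier R)
    → CommutativeRing._≈_ R (pow R ζ n) (CommutativeRing.1# R)
    → (w : ℕ → CommutativeRing.Carrier R)
    → (∀ i → 1 ≤ i → i < n →
         CommutativeRing._≈_ R
           (CommutativeRing._*_ R (w i) (CommutativeRing._-_ R (CommutativeRing.1# R) (pow R ζ i)))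
           (CommutativeRing.1# R))
    → CommutativeRing._≈_ R (sumR R 1 (n ∸ 1) (λ i → pow R (w i) s)) (ι (rhs n s))
theorem3 R ι ι-hom (suc m) s _ ζ ζⁿ≈1 w w-inverse = begin
  sumR R 1 m (λ i → pow R (w i) s)   ≈⟨ sum-cong 1 m (λ i → reflexive (pow≡^ (w i) s)) ⟩
  ∑ 1 m (λ i → w i ^ s)              ≈⟨ ∑wᵢˢ≈ι-rhs ζⁿ≈1′ w-inverse′ s ⟩
  ι (rhs (suc m) s)                  ∎
  where
  open CommutativeRing R
  open FiniteSums R
  open BernoulliSum R ι ι-hom m
  open ≈-Reasoning setoid
  ζⁿ≈1′ : ζ ^ suc m ≈ 1#
  ζⁿ≈1′ = trans (reflexive (≡.sym (pow≡^ ζ (suc m)))) ζⁿ≈1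
  w-inverse′ : ∀ i → 1 ≤ i → i < suc m → w i * (1# - ζ ^ i) ≈ 1#
  w-inverse′ i 1≤i i<n = trans (*-congˡ (+-congˡ (-‿cong (reflexive (≡.sym (pow≡^ ζ i)))))) (w-inverse i 1≤i i<n)
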